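{- Let $T$ be a tree and let $v$ be a vertex of $T$. Then $T$ has a consistent range-relaxed graceful labeling $f$ with $f(v)=0$.
   Context: A labeling of a tree $T$ is an injective map $f$ from the vertices of $T$ to the non-negative integers; the induced label of an edge $xy$ is $|f(x)-f(y)|$. The labeling is range-relaxed graceful if the induced edge labels are pairwise distinct. Writing $V_f$ for the set of vertex labels and $E_f$ for the set of induced edge labels, a range-relaxed graceful labeling is consistent if $V_f=E_f\cup\{0\}$. -}

module Defs where

open import Data.Nat using (ℕ; zero; suc; _∸_; _≤_)
open import Data.Nat.Base using (∣_-_∣)
open import Data.Fin using (Fin)
open import Data.Product using (_×_; _,_; ∃; Σ; proj₁; proj₂)
open import Data.Fin using (_≤?_)
open import Relation.Nullary using (yes; no)
open import Data.Sum using (_⊎_)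
open import Data.List using (List; []; _∷_; length; map)
open import Data.List.Membership.Propositional using (_∈_)
open import Data.List.Relation.Unary.All using (All)
open import Data.List.Relation.Unary.Unique.Propositional using (Unique)
open import Relation.Binary.PropositionalEquality using (_≡_; _≢_)
open import Relation.Nullary using (¬_)
open import Function.Definitions using (Injective)

record Graph (n : ℕ) : Set where
  field
    edges : List (Fin n × Fin n)
open Graph public

Adj : ∀ {n} → Graph n → Fin n → Fin n → Set
Adj G x y = ((x , y) ∈ edges G) ⊎ ((y , x) ∈ edges G)

Loopless : ∀ {n} → Graph n → Set
Loopless G = All (λ e → proj₁ e ≢ proj₂ e) (edges G)

unorder : ∀ {n} → Fin n × Fin n → Fin n × Fin n
unorder (x , y) with x ≤? y
... | yes _ = (x , y)
... | no _ = (y , x)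

IsSimple : ∀ {n} → Graph n → Set
IsSimple G = Loopless G × Unique (map unorder (edges G))

data Walk {n} (G : Graph n) : Fin n → Fin n → Set where
  here : ∀ {x} → Walk G x x
  step : ∀ {x y z} → Adj G x y → Walk G y z → Walk G x z

Connected : ∀ {n} → Graph n → Set
Connected G = ∀ x y → Walk G x y

IsTree : ∀ {n} → Graph n → Set
IsTree {n} G = 1 ≤ n × IsSimple G × Connected G × (length (edges G) ≡ n ∸ 1)

edgeLabels : ∀ {n} → Graph n → (Fin n → ℕ) → List ℕ
edgeLabels G f = map (λ e → ∣ f (proj₁ e) - f (proj₂ e) ∣) (edges G)

RangeRelaxedGraceful : ∀ {n} → Graph n → (Fin n → ℕ) → Set
RangeRelaxedGraceful G f = Injective _≡_ _≡_ f × Unique (edgeLabels G f)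

Consistent : ∀ {n} → Graph n → (Fin n → ℕ) → Set
Consistent {n} G f =
  RangeRelaxedGraceful G f ×
  (∀ k → (∃ λ x → f x ≡ k) → (k ≡ 0 ⊎ k ∈ edgeLabels G f)) ×
  (∀ k → (k ≡ 0 ⊎ k ∈ edgeLabels G f) → ∃ λ x → f x ≡ k)

module Submission where

-- Root T at v by breadth-first search: every vertex x ≠ v gets a parent one step closer to v,
-- and since T has n - 1 edges, counting shows that the edges of T are exactly the parent
-- edges {x, parent x}. The children of each non-root vertex are paired by reversing their
-- order (partner); the children of v are their own partners. It then suffices to find an
-- injective f with f v = 0 such that the parent edge of x is labelled f (partner x): the edge
-- labels are then the labels of the non-root vertices, each exactly once (Consistency). Such
-- an f must satisfy f x + f (partner x) = f (parent x) when parent x ≠ v; Labeling achieves this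
-- with f x = 2^(height - depth x) · (2 · N x + 1), where N x is a base-B number whose digits
-- record the path from v to x, so that f is injective by uniqueness of the 2-adic
-- factorisation and of base-B digits.

open import Defs
open import Data.Nat using (ℕ; zero; suc; pred; _+_; _*_; _∸_; _^_; _≤_; _<_; z≤n; s≤s; ∣_-_∣; NonZero)
open import Data.Nat.Properties
  using ( suc-injective; +-identityʳ; +-cancelˡ-≡; +-cancelʳ-≡; *-cancelˡ-≡; *-assoc; *-comm
        ; *-distribˡ-+; +-∸-assoc; *-monoʳ-≤; ≤-refl; ≤-reflexive; ≤-trans; ≤-<-trans; <-≤-trans
        ; ≤-antisym; <⇒≤; ≰⇒>; <-irrefl; n≤0⇒n≡0; pred[n]≤n; m≤m+n; m∸n≤m; m∸n+n≡m; m+[n∸m]≡n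
        ; m∸[m∸n]≡n; <⇒≤pred; ∸-cancelˡ-≡; m≢1+n+m; even≢odd; m^n≡0⇒m≡0; m*n≡0⇒m≡0∨n≡0
        ; ∣m-m+n∣≡n; ∣-∣-comm; ∣-∣-identityʳ; 0≢1+n )
open import Data.Nat.DivMod using (_%_; [m+kn]%n≡m%n; m<n⇒m%n≡m)
open import Data.Nat.Solver using (module +-*-Solver)
open import Data.Fin using (Fin; toℕ; punchIn)
import Data.Fin as Fin
import Data.Fin.Properties as Finₚ
open import Data.Fin.Properties using (any?; punchIn-injective; punchInᵢ≢i)
open import Data.List using (List; []; _∷_; length; map; filter; allFin)
open import Data.List.Properties using (length-map; length-filter; filter-notAll; length-tabulate)
open import Data.List.Membership.Propositional using (_∈_; _∉_)
open import Data.List.Membership.Propositional.Properties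
  using (∈-map⁺; ∈-map⁻; ∈-filter⁺; ∈-filter⁻; ∈-allFin)
import Data.List.Membership.DecPropositional as DecMembership
open import Data.List.Relation.Binary.Subset.Propositional using (_⊆_)
open import Data.List.Relation.Unary.Any using (here; there)
import Data.List.Relation.Unary.Any as Any
import Data.List.Relation.Unary.All as All
open import Data.List.Relation.Unary.All.Properties using (All¬⇒¬Any)
import Data.List.Relation.Unary.All.Properties as Allₚ
open import Data.List.Relation.Unary.AllPairs using ([]; _∷_)
open import Data.List.Relation.Unary.Unique.Propositional using (Unique)
import Data.List.Relation.Unary.Unique.Propositional.Properties as Uniqueₚ
open import Data.List.Extrema.Nat using (max; xs≤max)
open import Data.Vec.Functional using (Vector; updateAt)
open import Data.Vec.Functional.Properties using (updateAt-updates; updateAt-minimal)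
open import Data.Product using (Σ; ∃; _×_; _,_; proj₁; proj₂)
open import Data.Product.Properties using (≡-dec)
open import Data.Sum using (_⊎_; inj₁; inj₂)
open import Data.Empty using (⊥-elim)
open import Function using (_∘_; const)
open import Relation.Binary.Definitions using (DecidableEquality)
open import Relation.Binary.PropositionalEquality
open import Relation.Nullary using (Dec; yes; no)
open import Relation.Nullary.Decidable using (_×-dec_; _⊎-dec_; ¬?)

open +-*-Solver

module Counting {a} {A : Set a} (_≟_ : DecidableEquality A) where

  without : A → List A → List A
  without y = filter (λ z → ¬? (z ≟ y))

  length-without : ∀ {y ys} → y ∈ ys → length (without y ys) < length ys
  length-without {y} y∈ys =
    filter-notAll (λ z → ¬? (z ≟ y)) _ (Any.map (λ y≡z z≢y → z≢y (sym y≡z)) y∈ys)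

  ⊆-without : ∀ {y xs ys} → xs ⊆ ys → y ∉ xs → xs ⊆ without y ys
  ⊆-without {y} sub y∉xs z∈xs =
    ∈-filter⁺ (λ z → ¬? (z ≟ y)) (sub z∈xs) (λ z≡y → y∉xs (subst (_∈ _) z≡y z∈xs))

  unique-length-≤ : ∀ {xs ys} → Unique xs → xs ⊆ ys → length xs ≤ length ys
  unique-length-≤ [] _ = z≤n
  unique-length-≤ (x∉xs ∷ u) sub =
    ≤-trans (s≤s (unique-length-≤ u (⊆-without (sub ∘ there) (All¬⇒¬Any x∉xs))))
            (length-without (sub (here refl)))

  unique-⊆-exhausts : ∀ {xs ys} → Unique xs → xs ⊆ ys → length ys ≤ length xs → ys ⊆ xs
  unique-⊆-exhausts {xs} u sub long {y} y∈ys with DecMembership._∈?_ _≟_ y xs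
  ... | yes y∈xs = y∈xs
  ... | no  y∉xs = ⊥-elim (<-irrefl refl
        (<-≤-trans (≤-<-trans (unique-length-≤ u (⊆-without sub y∉xs)) (length-without y∈ys)) long))

unique-map-transfer : ∀ {a b c} {A : Set a} {B : Set b} {C : Set c} (g : A → B) (h : A → C) {xs : List A} →
  (∀ {x y} → x ∈ xs → y ∈ xs → g x ≡ g y → h x ≡ h y) → Unique (map h xs) → Unique (map g xs)
unique-map-transfer g h {[]} _ [] = []
unique-map-transfer g h {x ∷ xs} reflect (hx∉ ∷ u) =
  Allₚ.map⁺ (All.tabulate λ y∈xs gx≡gy → All.lookup (Allₚ.map⁻ hx∉) y∈xs (reflect (here refl) (there y∈xs) gx≡gy))
  ∷ unique-map-transfer g h (λ x∈ y∈ → reflect (there x∈) (there y∈)) u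

module Indexing {a} {A : Set a} (_≟_ : DecidableEquality A) (default : A) where

  -- position of the first occurrence of x in xs (length xs if there is none)
  indexOf : A → List A → ℕ
  indexOf x [] = 0
  indexOf x (y ∷ ys) with x ≟ y
  ... | yes _ = 0
  ... | no  _ = suc (indexOf x ys)

  _!_ : List A → ℕ → A
  []       ! _     = default
  (y ∷ ys) ! zero  = y
  (y ∷ ys) ! suc i = ys ! i

  indexOf≤length : ∀ x xs → indexOf x xs ≤ length xs
  indexOf≤length x [] = z≤n
  indexOf≤length x (y ∷ ys) with x ≟ y
  ... | yes _ = z≤n
  ... | no  _ = s≤s (indexOf≤length x ys)

  indexOf<length : ∀ {x xs} → x ∈ xs → indexOf x xs < length xs
  indexOf<length {x} {y ∷ ys} x∈ with x ≟ y
  indexOf<length {x} {y ∷ ys} x∈          | yes _  = s≤s z≤n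
  indexOf<length {x} {y ∷ ys} (here x≡y)  | no x≢y = ⊥-elim (x≢y x≡y)
  indexOf<length {x} {y ∷ ys} (there x∈)  | no _   = s≤s (indexOf<length x∈)

  !-indexOf : ∀ {x xs} → x ∈ xs → xs ! indexOf x xs ≡ x
  !-indexOf {x} {y ∷ ys} x∈ with x ≟ y
  !-indexOf {x} {y ∷ ys} x∈          | yes x≡y = sym x≡y
  !-indexOf {x} {y ∷ ys} (here x≡y)  | no x≢y  = ⊥-elim (x≢y x≡y)
  !-indexOf {x} {y ∷ ys} (there x∈)  | no _    = !-indexOf x∈

  !-∈ : ∀ {xs} i → i < length xs → xs ! i ∈ xs
  !-∈ {y ∷ ys} zero    _         = here refl
  !-∈ {y ∷ ys} (suc i) (s≤s i<) = there (!-∈ i i<)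

  indexOf-! : ∀ {xs} → Unique xs → ∀ i → i < length xs → indexOf (xs ! i) xs ≡ i
  indexOf-! {y ∷ ys} _ zero _ with y ≟ y
  ... | yes _   = refl
  ... | no y≢y  = ⊥-elim (y≢y refl)
  indexOf-! {y ∷ ys} (y∉ys ∷ u) (suc i) (s≤s i<) with (ys ! i) ≟ y
  ... | yes e = ⊥-elim (All.lookup y∉ys (!-∈ i i<) (sym e))
  ... | no  _ = cong suc (indexOf-! u i i<)

odd-part-unique : ∀ a b s t → 2 ^ a * suc (2 * s) ≡ 2 ^ b * suc (2 * t) → a ≡ b × s ≡ t
odd-part-unique zero zero s t eq =
  refl , *-cancelˡ-≡ s t 2 (suc-injective (trans (sym (+-identityʳ _)) (trans eq (+-identityʳ _))))
odd-part-unique zero (suc b) s t eq =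
  ⊥-elim (even≢odd (2 ^ b * suc (2 * t)) s (trans (sym (*-assoc 2 (2 ^ b) _)) (trans (sym eq) (+-identityʳ _))))
odd-part-unique (suc a) zero s t eq =
  ⊥-elim (even≢odd (2 ^ a * suc (2 * s)) t (trans (sym (*-assoc 2 (2 ^ a) _)) (trans eq (+-identityʳ _))))
odd-part-unique (suc a) (suc b) s t eq
  with odd-part-unique a b s t (*-cancelˡ-≡ _ _ 2 (trans (sym (*-assoc 2 (2 ^ a) _)) (trans eq (*-assoc 2 (2 ^ b) _))))
... | refl , s≡t = refl , s≡t

-- t·(2x+1) + t·(2y+1) = 2t·(2z+1) when x + y = 2z; with t a power of two this adds codes.
sum-of-odd-multiples : ∀ t x y z → x + y ≡ 2 * z → t * suc (2 * x) + t * suc (2 * y) ≡ (2 * t) * suc (2 * z)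
sum-of-odd-multiples t x y z x+y≡2z = begin
    t * suc (2 * x) + t * suc (2 * y)
  ≡⟨ solve 3 (λ t x y → t :* (con 1 :+ con 2 :* x) :+ t :* (con 1 :+ con 2 :* y) := t :* (con 2 :+ con 2 :* (x :+ y))) refl t x y ⟩
    t * (2 + 2 * (x + y))
  ≡⟨ cong (λ w → t * (2 + 2 * w)) x+y≡2z ⟩
    t * (2 + 2 * (2 * z))
  ≡⟨ solve 2 (λ t z → t :* (con 2 :+ con 2 :* (con 2 :* z)) := (con 2 :* t) :* (con 1 :+ con 2 :* z)) refl t z ⟩
    (2 * t) * suc (2 * z)
  ∎
  where open ≡-Reasoning

sum-of-replacements : ∀ X Y Z b q r s → X + b * q ≡ Z + r * q → Y + b * q ≡ Z + s * q → r + s ≡ 2 * b →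
                      X + Y ≡ 2 * Z
sum-of-replacements X Y Z b q r s X≡ Y≡ r+s≡2b = +-cancelʳ-≡ ((2 * b) * q) (X + Y) (2 * Z) (begin
    (X + Y) + (2 * b) * q
  ≡⟨ solve 4 (λ X Y b q → (X :+ Y) :+ (con 2 :* b) :* q := (X :+ b :* q) :+ (Y :+ b :* q)) refl X Y b q ⟩
    (X + b * q) + (Y + b * q)
  ≡⟨ cong₂ _+_ X≡ Y≡ ⟩
    (Z + r * q) + (Z + s * q)
  ≡⟨ solve 4 (λ Z r s q → (Z :+ r :* q) :+ (Z :+ s :* q) := con 2 :* Z :+ (r :+ s) :* q) refl Z r s q ⟩
    2 * Z + (r + s) * q
  ≡⟨ cong (λ w → 2 * Z + w * q) r+s≡2b ⟩
    2 * Z + (2 * b) * q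
  ∎)
  where open ≡-Reasoning

module Positional (B : ℕ) where

  value : ∀ {m} → Vector ℕ m → ℕ
  value {zero}  g = 0
  value {suc m} g = g Fin.zero + B * value (g ∘ Fin.suc)

  value-cong : ∀ {m} {g h : Vector ℕ m} → (∀ z → g z ≡ h z) → value g ≡ value h
  value-cong {zero}  _   = refl
  value-cong {suc m} g≗h = cong₂ (λ d w → d + B * w) (g≗h Fin.zero) (value-cong (g≗h ∘ Fin.suc))

  value-swap : ∀ {m} {g h : Vector ℕ m} (P : Fin m) → (∀ z → z ≢ P → g z ≡ h z) →
               value g + h P * B ^ toℕ P ≡ value h + g P * B ^ toℕ P
  value-swap {g = g} {h} Fin.zero agree =
    begin
      (g0 + B * value (g ∘ Fin.suc)) + h0 * 1
    ≡⟨ cong (λ w → (g0 + B * w) + h0 * 1) (value-cong (λ z → agree (Fin.suc z) λ ())) ⟩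
      (g0 + B * value (h ∘ Fin.suc)) + h0 * 1
    ≡⟨ solve 4 (λ b w g0 h0 → (g0 :+ b :* w) :+ h0 :* con 1 := (h0 :+ b :* w) :+ g0 :* con 1) refl B _ g0 h0 ⟩
      (h0 + B * value (h ∘ Fin.suc)) + g0 * 1
    ∎
    where open ≡-Reasoning
          g0 = g Fin.zero
          h0 = h Fin.zero
  value-swap {g = g} {h} (Fin.suc P) agree =
    begin
      (g0 + B * value g′) + hP * (B * q)
    ≡⟨ solve 5 (λ b g0 w hP q → (g0 :+ b :* w) :+ hP :* (b :* q) := g0 :+ b :* (w :+ hP :* q)) refl B g0 (value g′) hP q ⟩
      g0 + B * (value g′ + hP * q)
    ≡⟨ cong₂ (λ d w → d + B * w) (agree Fin.zero λ ()) (value-swap P (λ z z≢P → agree (Fin.suc z) (z≢P ∘ Finₚ.suc-injective))) ⟩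
      h0 + B * (value h′ + gP * q)
    ≡⟨ solve 5 (λ b h0 w gP q → h0 :+ b :* (w :+ gP :* q) := (h0 :+ b :* w) :+ gP :* (b :* q)) refl B h0 (value h′) gP q ⟩
      (h0 + B * value h′) + gP * (B * q)
    ∎
    where open ≡-Reasoning
          g0 = g Fin.zero
          h0 = h Fin.zero
          g′ = g ∘ Fin.suc
          h′ = h ∘ Fin.suc
          gP = g (Fin.suc P)
          hP = h (Fin.suc P)
          q  = B ^ toℕ P

  value-injective : .{{_ : NonZero B}} → ∀ {m} (g h : Vector ℕ m) →
                    (∀ z → g z < B) → (∀ z → h z < B) → value g ≡ value h → ∀ z → g z ≡ h z
  value-injective {suc m} g h g<B h<B eq = digit
    where
    lowest : ∀ d w → d < B → (d + B * w) % B ≡ d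
    lowest d w d<B = trans (cong (λ t → (d + t) % B) (*-comm B w)) (trans ([m+kn]%n≡m%n d w B) (m<n⇒m%n≡m d<B))
    g0≡h0 : g Fin.zero ≡ h Fin.zero
    g0≡h0 = trans (sym (lowest _ _ (g<B Fin.zero))) (trans (cong (_% B) eq) (lowest _ _ (h<B Fin.zero)))
    rest : value (g ∘ Fin.suc) ≡ value (h ∘ Fin.suc)
    rest = *-cancelˡ-≡ _ _ B (+-cancelˡ-≡ (g Fin.zero) _ _ (trans eq (cong (_+ _) (sym g0≡h0))))
    digit : ∀ z → g z ≡ h z
    digit Fin.zero    = g0≡h0
    digit (Fin.suc z) = value-injective (g ∘ Fin.suc) (h ∘ Fin.suc) (g<B ∘ Fin.suc) (h<B ∘ Fin.suc) rest z

unorder-comm : ∀ {n} (a b : Fin n) → unorder (a , b) ≡ unorder (b , a)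
unorder-comm a b with a Fin.≤? b | b Fin.≤? a
... | yes a≤b | yes b≤a rewrite Finₚ.≤-antisym a≤b b≤a = refl
... | yes _   | no _    = refl
... | no _    | yes _   = refl
... | no a≰b  | no b≰a  with Finₚ.≤-total a b
...   | inj₁ a≤b = ⊥-elim (a≰b a≤b)
...   | inj₂ b≤a = ⊥-elim (b≰a b≤a)

unorder-cases : ∀ {n} (a b c d : Fin n) → unorder (a , b) ≡ unorder (c , d) →
                (a ≡ c × b ≡ d) ⊎ (a ≡ d × b ≡ c)
unorder-cases a b c d eq with a Fin.≤? b | c Fin.≤? d
unorder-cases a b c d refl | yes _ | yes _ = inj₁ (refl , refl)
unorder-cases a b c d refl | yes _ | no _  = inj₂ (refl , refl)
unorder-cases a b c d refl | no _  | yes _ = inj₂ (refl , refl)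
unorder-cases a b c d refl | no _  | no _  = inj₁ (refl , refl)

module LeastWitness {p} {P : ℕ → Set p} (P? : ∀ k → Dec (P k)) (up : ∀ {k} → P k → P (suc k)) where

  upward : ∀ {j k} → j ≤ k → P j → P k
  upward {j} {k} j≤k w = subst P (m∸n+n≡m j≤k) (lift (k ∸ j))
    where
    lift : ∀ i → P (i + j)
    lift zero    = w
    lift (suc i) = up (lift i)

  least-witness : ∀ k → P k → Σ ℕ λ m → P m × (∀ j → P j → m ≤ j)
  least-witness zero    w = 0 , w , λ _ _ → z≤n
  least-witness (suc k) w with P? k
  ... | yes wk  = least-witness k wk
  ... | no  ¬wk = suc k , w , λ j wj → ≰⇒> (λ j≤k → ¬wk (upward j≤k wj))

module BreadthFirst {n} (T : Graph n) (connected : Connected T) (v : Fin n) where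

  Adj? : ∀ x y → Dec (Adj T x y)
  Adj? x y = (x , y) ∈? edges T ⊎-dec (y , x) ∈? edges T
    where open DecMembership (≡-dec Fin._≟_ Fin._≟_) using (_∈?_)

  -- Near k x: some walk from x to v has at most k edges
  Near : ℕ → Fin n → Set
  Near zero    x = x ≡ v
  Near (suc k) x = Near k x ⊎ ∃ λ y → Adj T x y × Near k y

  Near? : ∀ k x → Dec (Near k x)
  Near? zero    x = x Fin.≟ v
  Near? (suc k) x = Near? k x ⊎-dec any? (λ y → Adj? x y ×-dec Near? k y)

  walk-near : ∀ {x} → Walk T x v → ∃ λ k → Near k x
  walk-near here = 0 , refl
  walk-near (step x~y w) with walk-near w
  ... | k , near = suc k , inj₂ (_ , x~y , near)

  distance : ∀ x → Σ ℕ λ m → Near m x × (∀ j → Near j x → m ≤ j)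
  distance x = least-witness (proj₁ (walk-near (connected x v))) (proj₂ (walk-near (connected x v)))
    where open LeastWitness (λ k → Near? k x) inj₁

  depth : Fin n → ℕ
  depth x = proj₁ (distance x)

  depth-near : ∀ x → Near (depth x) x
  depth-near x = proj₁ (proj₂ (distance x))

  depth-min : ∀ x k → Near k x → depth x ≤ k
  depth-min x = proj₂ (proj₂ (distance x))

  depth-root : depth v ≡ 0
  depth-root = n≤0⇒n≡0 (depth-min v 0 refl)

  depth-zero : ∀ {x} → depth x ≡ 0 → x ≡ v
  depth-zero {x} eq = subst (λ k → Near k x) eq (depth-near x)

  depth-suc : ∀ {x} → x ≢ v → depth x ≡ suc (pred (depth x))
  depth-suc {x} x≢v with depth x in eq
  ... | zero  = ⊥-elim (x≢v (depth-zero eq))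
  ... | suc _ = refl

  closer? : ∀ x → Dec (∃ λ y → Adj T x y × Near (pred (depth x)) y)
  closer? x = any? (λ y → Adj? x y ×-dec Near? (pred (depth x)) y)

  -- a neighbour one step closer to v (x itself if there is none, which happens only for v)
  parent : Fin n → Fin n
  parent x with closer? x
  ... | yes (y , _) = y
  ... | no _        = x

  parent-spec : ∀ {x} → x ≢ v → Adj T x (parent x) × depth x ≡ suc (depth (parent x))
  parent-spec {x} x≢v with closer? x
  ... | yes (y , x~y , near-y) = x~y , ≤-antisym
        (depth-min x _ (inj₂ (y , x~y , depth-near y)))
        (subst (suc (depth y) ≤_) (sym (depth-suc x≢v)) (s≤s (depth-min y _ near-y)))
  ... | no none with subst (λ k → Near k x) (depth-suc x≢v) (depth-near x)
  ...   | inj₁ near   = ⊥-elim (<-irrefl refl (subst (_≤ pred (depth x)) (depth-suc x≢v) (depth-min x _ near)))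
  ...   | inj₂ closer = ⊥-elim (none closer)

  parent-adjacent : ∀ {x} → x ≢ v → Adj T x (parent x)
  parent-adjacent = proj₁ ∘ parent-spec

  depth-parent : ∀ {x} → x ≢ v → depth x ≡ suc (depth (parent x))
  depth-parent = proj₂ ∘ parent-spec

-- In a tree the edges are exactly the parent edges: the n - 1 parent edges of the
-- non-root vertices are distinct edges, hence by counting they are all the edges.
module ParentEdges {m} (T : Graph (suc m)) (tree : IsTree T) (v : Fin (suc m)) where

  open BreadthFirst T (proj₁ (proj₂ (proj₂ tree))) v public
  open Counting (≡-dec (Fin._≟_ {suc m}) (Fin._≟_ {suc m})) using (unique-⊆-exhausts)

  parentEdge : Fin (suc m) → Fin (suc m) × Fin (suc m)
  parentEdge x = unorder (x , parent x)

  -- the parent edges of distinct non-root vertices differ: sharing an edge in swapped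
  -- orientation would force depth x = depth x + 2
  parentEdge-injective : ∀ {x y} → x ≢ v → y ≢ v → parentEdge x ≡ parentEdge y → x ≡ y
  parentEdge-injective {x} {y} x≢v y≢v eq with unorder-cases x (parent x) y (parent y) eq
  ... | inj₁ (x≡y , _)     = x≡y
  ... | inj₂ (x≡py , px≡y) = ⊥-elim (m≢1+n+m (depth x) (begin
      depth x                       ≡⟨ depth-parent x≢v ⟩
      suc (depth (parent x))        ≡⟨ cong (suc ∘ depth) px≡y ⟩
      suc (depth y)                 ≡⟨ cong suc (depth-parent y≢v) ⟩
      suc (suc (depth (parent y)))  ≡⟨ cong (suc ∘ suc ∘ depth) (sym x≡py) ⟩
      suc (suc (depth x))           ∎))
    where open ≡-Reasoning

  parentEdge-∈ : ∀ {x} → x ≢ v → parentEdge x ∈ map unorder (edges T)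
  parentEdge-∈ {x} x≢v with parent-adjacent x≢v
  ... | inj₁ x→px = ∈-map⁺ unorder x→px
  ... | inj₂ px→x = subst (_∈ map unorder (edges T)) (unorder-comm (parent x) x) (∈-map⁺ unorder px→x)

  parentEdges : List (Fin (suc m) × Fin (suc m))
  parentEdges = map (parentEdge ∘ punchIn v) (allFin m)

  parentEdges-unique : Unique parentEdges
  parentEdges-unique = Uniqueₚ.map⁺
    (λ {i} {j} eq → punchIn-injective v i j (parentEdge-injective (punchInᵢ≢i v i) (punchInᵢ≢i v j) eq))
    (Uniqueₚ.allFin⁺ m)

  parentEdges-⊆ : parentEdges ⊆ map unorder (edges T)
  parentEdges-⊆ e∈ with ∈-map⁻ (parentEdge ∘ punchIn v) e∈
  ... | i , _ , refl = parentEdge-∈ (punchInᵢ≢i v i)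

  parentEdges-long : length (map unorder (edges T)) ≤ length parentEdges
  parentEdges-long = ≤-reflexive (begin
      length (map unorder (edges T))  ≡⟨ length-map unorder (edges T) ⟩
      length (edges T)                ≡⟨ proj₂ (proj₂ (proj₂ tree)) ⟩
      m                               ≡⟨ sym (length-tabulate (λ i → i)) ⟩
      length (allFin m)               ≡⟨ sym (length-map (parentEdge ∘ punchIn v) (allFin m)) ⟩
      length parentEdges              ∎)
    where open ≡-Reasoning

  edge-is-parent-edge : ∀ {e} → e ∈ edges T → ∃ λ x → x ≢ v × (e ≡ (x , parent x) ⊎ e ≡ (parent x , x))
  edge-is-parent-edge {a , b} e∈ with ∈-map⁻ (parentEdge ∘ punchIn v)
    (unique-⊆-exhausts parentEdges-unique parentEdges-⊆ parentEdges-long (∈-map⁺ unorder e∈))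
  ... | i , _ , eq with unorder-cases a b (punchIn v i) (parent (punchIn v i)) eq
  ...   | inj₁ (refl , refl) = punchIn v i , punchInᵢ≢i v i , inj₁ refl
  ...   | inj₂ (refl , refl) = punchIn v i , punchInᵢ≢i v i , inj₂ refl

module Siblings {n} (v : Fin n) (parent : Fin n → Fin n) where

  open Indexing Fin._≟_ v

  IsChild : Fin n → Fin n → Set
  IsChild P y = y ≢ v × parent y ≡ P

  isChild? : ∀ P y → Dec (IsChild P y)
  isChild? P y = ¬? (y Fin.≟ v) ×-dec (parent y Fin.≟ P)

  children : Fin n → List (Fin n)
  children P = filter (isChild? P) (allFin n)

  #children : Fin n → ℕ
  #children P = length (children P)

  rank : Fin n → ℕ
  rank x = indexOf x (children (parent x))

  partner : Fin n → Fin n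
  partner x with parent x Fin.≟ v
  ... | yes _ = x
  ... | no  _ = children (parent x) ! (pred (#children (parent x)) ∸ rank x)

  children-unique : ∀ P → Unique (children P)
  children-unique P = Uniqueₚ.filter⁺ _ (Uniqueₚ.allFin⁺ n)

  ∈-children : ∀ {x} → x ≢ v → x ∈ children (parent x)
  ∈-children {x} x≢v = ∈-filter⁺ (isChild? (parent x)) (∈-allFin x) (x≢v , refl)

  children-spec : ∀ {P y} → y ∈ children P → IsChild P y
  children-spec {P} y∈ = proj₂ (∈-filter⁻ (isChild? P) {xs = allFin n} y∈)

  #children≤n : ∀ P → #children P ≤ n
  #children≤n P = ≤-trans (length-filter _ (allFin n)) (≤-reflexive (length-tabulate (λ i → i)))

  rank≤n : ∀ x → rank x ≤ n
  rank≤n x = ≤-trans (indexOf≤length x (children (parent x))) (#children≤n (parent x))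

  rank≤last : ∀ {x} → x ≢ v → rank x ≤ pred (#children (parent x))
  rank≤last x≢v = <⇒≤pred (indexOf<length (∈-children x≢v))

  rank-injective : ∀ {x y} → x ≢ v → y ≢ v → parent x ≡ parent y → rank x ≡ rank y → x ≡ y
  rank-injective {x} {y} x≢v y≢v px≡py rx≡ry = begin
    x                                 ≡⟨ sym (!-indexOf (∈-children x≢v)) ⟩
    children (parent x) ! rank x      ≡⟨ cong₂ (λ P r → children P ! r) px≡py rx≡ry ⟩
    children (parent y) ! rank y      ≡⟨ !-indexOf (∈-children y≢v) ⟩
    y                                 ∎
    where open ≡-Reasoning

  partner-of-root-child : ∀ {x} → parent x ≡ v → partner x ≡ x
  partner-of-root-child {x} px≡v with parent x Fin.≟ v
  ... | yes _   = refl
  ... | no px≢v = ⊥-elim (px≢v px≡v)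

  partner-inner : ∀ {x} → parent x ≢ v → partner x ≡ children (parent x) ! (pred (#children (parent x)) ∸ rank x)
  partner-inner {x} px≢v with parent x Fin.≟ v
  ... | yes px≡v = ⊥-elim (px≢v px≡v)
  ... | no _     = refl

  mirrored-rank< : ∀ {x} → x ≢ v → pred (#children (parent x)) ∸ rank x < #children (parent x)
  mirrored-rank< {x} x≢v with #children (parent x) | indexOf<length (∈-children x≢v)
  ... | suc k | _ = s≤s (m∸n≤m k (rank x))

  partner-∈ : ∀ {x} → x ≢ v → parent x ≢ v → partner x ∈ children (parent x)
  partner-∈ {x} x≢v px≢v = subst (_∈ children (parent x)) (sym (partner-inner px≢v)) (!-∈ _ (mirrored-rank< x≢v))

  partner-nonroot : ∀ {x} → x ≢ v → partner x ≢ v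
  partner-nonroot {x} x≢v = by-cases (parent x Fin.≟ v)
    where
    by-cases : Dec (parent x ≡ v) → partner x ≢ v
    by-cases (yes px≡v) = subst (_≢ v) (sym (partner-of-root-child px≡v)) x≢v
    by-cases (no  px≢v) = proj₁ (children-spec (partner-∈ x≢v px≢v))

  partner-parent : ∀ {x} → x ≢ v → parent x ≢ v → parent (partner x) ≡ parent x
  partner-parent x≢v px≢v = proj₂ (children-spec (partner-∈ x≢v px≢v))

  rank-partner : ∀ {x} → x ≢ v → parent x ≢ v → rank (partner x) ≡ pred (#children (parent x)) ∸ rank x
  rank-partner {x} x≢v px≢v = begin
      indexOf (partner x) (children (parent (partner x)))
    ≡⟨ cong (λ P → indexOf (partner x) (children P)) (partner-parent x≢v px≢v) ⟩
      indexOf (partner x) (children (parent x))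
    ≡⟨ cong (λ y → indexOf y (children (parent x))) (partner-inner px≢v) ⟩
      indexOf (children (parent x) ! (pred (#children (parent x)) ∸ rank x)) (children (parent x))
    ≡⟨ indexOf-! (children-unique (parent x)) _ (mirrored-rank< x≢v) ⟩
      pred (#children (parent x)) ∸ rank x
    ∎
    where open ≡-Reasoning

  rank-sum : ∀ {x} → x ≢ v → parent x ≢ v → rank x + rank (partner x) ≡ pred (#children (parent x))
  rank-sum {x} x≢v px≢v = trans (cong (rank x +_) (rank-partner x≢v px≢v)) (m+[n∸m]≡n (rank≤last x≢v))

  partner-involutive : ∀ {x} → x ≢ v → partner (partner x) ≡ x
  partner-involutive {x} x≢v = by-cases (parent x Fin.≟ v)
    where
    by-cases : Dec (parent x ≡ v) → partner (partner x) ≡ x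
    by-cases (yes px≡v) = trans (partner-of-root-child (trans (cong parent (partner-of-root-child px≡v)) px≡v))
                                (partner-of-root-child px≡v)
    by-cases (no  px≢v) = rank-injective (partner-nonroot (partner-nonroot x≢v)) x≢v
        (trans (partner-parent (partner-nonroot x≢v) ppx≢v) (partner-parent x≢v px≢v))
        (begin
          rank (partner (partner x))
        ≡⟨ rank-partner (partner-nonroot x≢v) ppx≢v ⟩
          pred (#children (parent (partner x))) ∸ rank (partner x)
        ≡⟨ cong₂ (λ P r → pred (#children P) ∸ r) (partner-parent x≢v px≢v) (rank-partner x≢v px≢v) ⟩
          pred (#children (parent x)) ∸ (pred (#children (parent x)) ∸ rank x)
        ≡⟨ m∸[m∸n]≡n (rank≤last x≢v) ⟩
          rank x
        ∎)
      where
      open ≡-Reasoning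
      ppx≢v : parent (partner x) ≢ v
      ppx≢v = subst (_≢ v) (sym (partner-parent x≢v px≢v)) px≢v

-- A vertex x gets the code
--   code x = 2^(height - depth x) · (2 · value (digits x) + 1),
-- where digits x is a base-B digit vector indexed by the vertices: the digit at a proper
-- ancestor z of x is twice the rank of the child of z on the way to x, and every other digit
-- z is #children z - 1. Partners x, partner x differ from their parent only in the digit at
-- the parent, where their ranks add up to #children - 1, so code x + code (partner x) equals
-- code (parent x).
module Labeling {n} (v : Fin n) (parent : Fin n → Fin n) (depth : Fin n → ℕ)
  (depth-root : depth v ≡ 0) (depth-zero : ∀ {x} → depth x ≡ 0 → x ≡ v)
  (depth-parent : ∀ {x} → x ≢ v → depth x ≡ suc (depth (parent x))) where

  open Siblings v parent public

  -- all digits are at most 2n (ranks and child counts are below n), so base 2n + 1 suffices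
  B : ℕ
  B = suc (2 * n)

  open Positional B

  default : Vector ℕ n
  default z = pred (#children z)

  digitsAt : ℕ → Fin n → Vector ℕ n
  digitsAt zero    _ = default
  digitsAt (suc k) x = updateAt (digitsAt k (parent x)) (parent x) (const (2 * rank x))

  digits : Fin n → Vector ℕ n
  digits x = digitsAt (depth x) x

  nonroot : ∀ {x k} → depth x ≡ suc k → x ≢ v
  nonroot dx≡1+k refl = 0≢1+n (trans (sym depth-root) dx≡1+k)

  depth-of-parent : ∀ {x k} → depth x ≡ suc k → depth (parent x) ≡ k
  depth-of-parent dx≡1+k = suc-injective (trans (sym (depth-parent (nonroot dx≡1+k))) dx≡1+k)

  digits-step : ∀ {x} → x ≢ v → digits x ≡ updateAt (digits (parent x)) (parent x) (const (2 * rank x))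
  digits-step {x} x≢v = cong (λ k → digitsAt k x) (depth-parent x≢v)

  digit-at-parent : ∀ {x} → x ≢ v → digits x (parent x) ≡ 2 * rank x
  digit-at-parent {x} x≢v =
    trans (cong-app (digits-step x≢v) (parent x)) (updateAt-updates (parent x) (digits (parent x)))

  digit-off-parent : ∀ {x z} → x ≢ v → z ≢ parent x → digits x z ≡ digits (parent x) z
  digit-off-parent {x} {z} x≢v z≢px =
    trans (cong-app (digits-step x≢v) z) (updateAt-minimal z (parent x) (digits (parent x)) z≢px)

  digit-untouched : ∀ {x z} → depth x ≤ depth z → digits x z ≡ default z
  digit-untouched {x} {z} = go (depth x) x refl
    where
    go : ∀ k y → depth y ≡ k → k ≤ depth z → digits y z ≡ default z
    go zero    y dy≡0   _     = cong (λ k → digitsAt k y z) dy≡0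
    go (suc k) y dy≡1+k 1+k≤dz = trans (digit-off-parent (nonroot dy≡1+k) z≢py)
                                       (go k (parent y) (depth-of-parent dy≡1+k) (<⇒≤ 1+k≤dz))
      where
      z≢py : z ≢ parent y
      z≢py refl = <-irrefl (sym (depth-of-parent dy≡1+k)) 1+k≤dz

  digit-bound : ∀ k x z → digitsAt k x z ≤ 2 * n
  digit-bound zero    x z = ≤-trans pred[n]≤n (≤-trans (#children≤n z) (m≤m+n n (n + 0)))
  digit-bound (suc k) x z with z Fin.≟ parent x
  ... | yes refl = subst (_≤ 2 * n) (sym (updateAt-updates (parent x) (digitsAt k (parent x))))
                         (*-monoʳ-≤ 2 (rank≤n x))
  ... | no z≢px  = subst (_≤ 2 * n) (sym (updateAt-minimal z (parent x) (digitsAt k (parent x)) z≢px))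
                         (digit-bound k (parent x) z)

  value-step : ∀ {x} → x ≢ v → value (digits x) + default (parent x) * B ^ toℕ (parent x)
                              ≡ value (digits (parent x)) + (2 * rank x) * B ^ toℕ (parent x)
  value-step {x} x≢v =
    subst₂ (λ a b → value (digits x) + a * q ≡ value (digits (parent x)) + b * q)
      (digit-untouched ≤-refl) (digit-at-parent x≢v)
      (value-swap (parent x) (λ z → digit-off-parent x≢v))
    where q = B ^ toℕ (parent x)

  value-partners : ∀ {x} → x ≢ v → parent x ≢ v →
                   value (digits x) + value (digits (partner x)) ≡ 2 * value (digits (parent x))
  value-partners {x} x≢v px≢v = sum-of-replacements
    (value (digits x)) (value (digits (partner x))) (value (digits (parent x)))
    (default (parent x)) (B ^ toℕ (parent x)) (2 * rank x) (2 * rank (partner x))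
    (value-step x≢v)
    (subst (λ P → value (digits (partner x)) + default P * B ^ toℕ P ≡ value (digits P) + (2 * rank (partner x)) * B ^ toℕ P)
      (partner-parent x≢v px≢v) (value-step (partner-nonroot x≢v)))
    (trans (sym (*-distribˡ-+ 2 (rank x) _)) (cong (2 *_) (rank-sum x≢v px≢v)))

  height : ℕ
  height = max 0 (map depth (allFin n))

  depth≤height : ∀ x → depth x ≤ height
  depth≤height x = All.lookup (xs≤max 0 (map depth (allFin n))) (∈-map⁺ depth (∈-allFin x))

  code : Fin n → ℕ
  code x = 2 ^ (height ∸ depth x) * suc (2 * value (digits x))

  code-partners : ∀ {x} → x ≢ v → parent x ≢ v → code x + code (partner x) ≡ code (parent x)
  code-partners {x} x≢v px≢v = begin
      code x + code (partner x)
    ≡⟨ cong (λ d → code x + 2 ^ (height ∸ d) * suc (2 * Y)) depth-partner ⟩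
      2 ^ (height ∸ depth x) * suc (2 * X) + 2 ^ (height ∸ depth x) * suc (2 * Y)
    ≡⟨ sum-of-odd-multiples (2 ^ (height ∸ depth x)) X Y (value (digits (parent x))) (value-partners x≢v px≢v) ⟩
      2 ^ suc (height ∸ depth x) * suc (2 * value (digits (parent x)))
    ≡⟨ cong (λ e → 2 ^ e * suc (2 * value (digits (parent x)))) (sym exponent) ⟩
      code (parent x)
    ∎
    where
    open ≡-Reasoning
    X = value (digits x)
    Y = value (digits (partner x))
    depth-partner : depth (partner x) ≡ depth x
    depth-partner = trans (depth-parent (partner-nonroot x≢v))
      (trans (cong (suc ∘ depth) (partner-parent x≢v px≢v)) (sym (depth-parent x≢v)))
    exponent : height ∸ depth (parent x) ≡ suc (height ∸ depth x)
    exponent = trans (+-∸-assoc 1 (subst (_≤ height) (depth-parent x≢v) (depth≤height x)))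
                     (cong (λ d → suc (height ∸ d)) (sym (depth-parent x≢v)))

  code≢0 : ∀ x → code x ≢ 0
  code≢0 x eq with m*n≡0⇒m≡0∨n≡0 (2 ^ (height ∸ depth x)) eq
  ... | inj₁ 2^e≡0 with m^n≡0⇒m≡0 2 (height ∸ depth x) 2^e≡0
  ...   | ()
  code≢0 x eq | inj₂ ()

  digits-parents : ∀ {x y k} → depth x ≡ suc k → depth y ≡ suc k →
                   (∀ z → digits x z ≡ digits y z) → ∀ z → digits (parent x) z ≡ digits (parent y) z
  digits-parents {x} {y} dx dy same z = compare (z Fin.≟ parent x) (z Fin.≟ parent y)
    where
    level : depth (parent x) ≡ depth (parent y)
    level = trans (depth-of-parent dx) (sym (depth-of-parent dy))
    compare : Dec (z ≡ parent x) → Dec (z ≡ parent y) → digits (parent x) z ≡ digits (parent y) z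
    compare (yes refl) _ = trans (digit-untouched ≤-refl) (sym (digit-untouched (≤-reflexive (sym level))))
    compare (no _) (yes refl) = trans (digit-untouched (≤-reflexive level)) (sym (digit-untouched ≤-refl))
    compare (no z≢px) (no z≢py) =
      trans (sym (digit-off-parent (nonroot dx) z≢px)) (trans (same z) (digit-off-parent (nonroot dy) z≢py))

  digits-determine : ∀ k x y → depth x ≡ k → depth y ≡ k → (∀ z → digits x z ≡ digits y z) → x ≡ y
  digits-determine zero    x y dx dy _    = trans (depth-zero dx) (sym (depth-zero dy))
  digits-determine (suc k) x y dx dy same =
    rank-injective (nonroot dx) (nonroot dy) px≡py (*-cancelˡ-≡ (rank x) (rank y) 2 (begin
      2 * rank x           ≡⟨ sym (digit-at-parent (nonroot dx)) ⟩
      digits x (parent x)  ≡⟨ same (parent x) ⟩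
      digits y (parent x)  ≡⟨ cong (digits y) px≡py ⟩
      digits y (parent y)  ≡⟨ digit-at-parent (nonroot dy) ⟩
      2 * rank y           ∎))
    where
    open ≡-Reasoning
    px≡py : parent x ≡ parent y
    px≡py = digits-determine k (parent x) (parent y) (depth-of-parent dx) (depth-of-parent dy)
              (digits-parents dx dy same)

  -- the 2-adic valuation of the code recovers the depth, its odd part the digits
  code-injective : ∀ {x y} → code x ≡ code y → x ≡ y
  code-injective {x} {y} eq
    with odd-part-unique (height ∸ depth x) (height ∸ depth y) (value (digits x)) (value (digits y)) eq
  ... | exponents , odd-parts = digits-determine (depth x) x y refl
          (sym (∸-cancelˡ-≡ (depth≤height x) (depth≤height y) exponents))
          (value-injective (digits x) (digits y) (digit< x) (digit< y) odd-parts)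
    where
    digit< : ∀ x z → digits x z < B
    digit< x z = s≤s (digit-bound (depth x) x z)

  label : Fin n → ℕ
  label x with x Fin.≟ v
  ... | yes _ = 0
  ... | no  _ = code x

  label-root : label v ≡ 0
  label-root with v Fin.≟ v
  ... | yes _   = refl
  ... | no v≢v  = ⊥-elim (v≢v refl)

  label-nonroot : ∀ {x} → x ≢ v → label x ≡ code x
  label-nonroot {x} x≢v with x Fin.≟ v
  ... | yes x≡v = ⊥-elim (x≢v x≡v)
  ... | no  _   = refl

  label-injective : ∀ {x y} → label x ≡ label y → x ≡ y
  label-injective {x} {y} eq with x Fin.≟ v | y Fin.≟ v
  ... | yes x≡v | yes y≡v = trans x≡v (sym y≡v)
  ... | yes _   | no  _   = ⊥-elim (code≢0 y (sym eq))
  ... | no  _   | yes _   = ⊥-elim (code≢0 x eq)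
  ... | no  _   | no  _   = code-injective eq

  label-edge : ∀ {x} → x ≢ v → ∣ label x - label (parent x) ∣ ≡ label (partner x)
  label-edge {x} x≢v = by-cases (parent x Fin.≟ v)
    where
    by-cases : Dec (parent x ≡ v) → ∣ label x - label (parent x) ∣ ≡ label (partner x)
    by-cases (yes px≡v) = begin
        ∣ label x - label (parent x) ∣  ≡⟨ cong (λ P → ∣ label x - label P ∣) px≡v ⟩
        ∣ label x - label v ∣           ≡⟨ cong (λ l → ∣ label x - l ∣) label-root ⟩
        ∣ label x - 0 ∣                 ≡⟨ ∣-∣-identityʳ (label x) ⟩
        label x                         ≡⟨ cong label (sym (partner-of-root-child px≡v)) ⟩
        label (partner x)               ∎
      where open ≡-Reasoning
    by-cases (no px≢v) = begin
        ∣ label x - label (parent x) ∣                    ≡⟨ cong (λ l → ∣ label x - l ∣) (sym partners) ⟩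
        ∣ label x - label x + label (partner x) ∣         ≡⟨ ∣m-m+n∣≡n (label x) (label (partner x)) ⟩
        label (partner x)                                  ∎
      where
      open ≡-Reasoning
      partners : label x + label (partner x) ≡ label (parent x)
      partners = begin
        label x + label (partner x)  ≡⟨ cong₂ _+_ (label-nonroot x≢v) (label-nonroot (partner-nonroot x≢v)) ⟩
        code x + code (partner x)    ≡⟨ code-partners x≢v px≢v ⟩
        code (parent x)              ≡⟨ sym (label-nonroot px≢v) ⟩
        label (parent x)             ∎

-- A labelling f with f v = 0 is consistent once (i) the edges are exactly the parent edges
-- {x, parent x} of the non-root vertices, and (ii) the parent edge of x is labelled
-- f (partner x) for an involution partner of the non-root vertices: then the edge labels
-- are the labels of the non-root vertices, each occurring once.
module Consistency {n} (T : Graph n) (v : Fin n) (parent partner : Fin n → Fin n) (f : Fin n → ℕ)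
  (edges-unique : Unique (map unorder (edges T)))
  (edge-is-parent-edge : ∀ {e} → e ∈ edges T → ∃ λ x → x ≢ v × (e ≡ (x , parent x) ⊎ e ≡ (parent x , x)))
  (parent-adjacent : ∀ {x} → x ≢ v → Adj T x (parent x))
  (partner-nonroot : ∀ {x} → x ≢ v → partner x ≢ v)
  (partner-involutive : ∀ {x} → x ≢ v → partner (partner x) ≡ x)
  (f-injective : ∀ {x y} → f x ≡ f y → x ≡ y)
  (f-root : f v ≡ 0)
  (f-edge : ∀ {x} → x ≢ v → ∣ f x - f (parent x) ∣ ≡ f (partner x)) where

  edgeLabel : Fin n × Fin n → ℕ
  edgeLabel (a , b) = ∣ f a - f b ∣

  edge-label : ∀ {e} → e ∈ edges T → ∃ λ x → x ≢ v × edgeLabel e ≡ f (partner x) × unorder e ≡ unorder (x , parent x)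
  edge-label e∈ with edge-is-parent-edge e∈
  ... | x , x≢v , inj₁ refl = x , x≢v , f-edge x≢v , refl
  ... | x , x≢v , inj₂ refl = x , x≢v , trans (∣-∣-comm (f (parent x)) (f x)) (f-edge x≢v) , unorder-comm (parent x) x

  labels-unique : Unique (edgeLabels T f)
  labels-unique = unique-map-transfer edgeLabel unorder same-label⇒same-edge edges-unique
    where
    same-label⇒same-edge : ∀ {a b} → a ∈ edges T → b ∈ edges T → edgeLabel a ≡ edgeLabel b → unorder a ≡ unorder b
    same-label⇒same-edge a∈ b∈ eq with edge-label a∈ | edge-label b∈
    ... | x , x≢v , la , ua | y , y≢v , lb , ub = trans ua (trans (cong (λ z → unorder (z , parent z)) x≡y) (sym ub))
      where
      x≡y : x ≡ y
      x≡y = trans (sym (partner-involutive x≢v))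
              (trans (cong partner (f-injective (trans (sym la) (trans eq lb)))) (partner-involutive y≢v))

  vertex-label-on-edge : ∀ {x} → x ≢ v → f x ∈ edgeLabels T f
  vertex-label-on-edge {x} x≢v with parent-adjacent (partner-nonroot x≢v)
  ... | inj₁ y→py = subst (_∈ edgeLabels T f) label≡ (∈-map⁺ edgeLabel y→py)
    where label≡ = trans (f-edge (partner-nonroot x≢v)) (cong f (partner-involutive x≢v))
  ... | inj₂ py→y = subst (_∈ edgeLabels T f) label≡ (∈-map⁺ edgeLabel py→y)
    where label≡ = trans (∣-∣-comm (f (parent (partner x))) (f (partner x)))
                         (trans (f-edge (partner-nonroot x≢v)) (cong f (partner-involutive x≢v)))

  consistent : Consistent T f
  consistent = (f-injective , labels-unique) , vertices⊆edges , edges⊆vertices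
    where
    vertices⊆edges : ∀ k → (∃ λ x → f x ≡ k) → k ≡ 0 ⊎ k ∈ edgeLabels T f
    vertices⊆edges _ (x , refl) with x Fin.≟ v
    ... | yes refl = inj₁ f-root
    ... | no  x≢v  = inj₂ (vertex-label-on-edge x≢v)
    edges⊆vertices : ∀ k → k ≡ 0 ⊎ k ∈ edgeLabels T f → ∃ λ x → f x ≡ k
    edges⊆vertices _ (inj₁ refl) = v , f-root
    edges⊆vertices _ (inj₂ k∈) with ∈-map⁻ edgeLabel k∈
    ... | e , e∈ , refl with edge-label e∈
    ...   | x , _ , label≡ , _ = partner x , sym label≡

mainTheorem9 : ∀ {n} (T : Graph n) → IsTree T → (v : Fin n) →
    Σ (Fin n → ℕ) (λ f → Consistent T f × f v ≡ 0)
mainTheorem9 {zero}  T tree ()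
mainTheorem9 {suc m} T tree v = label , consistent , label-root
  where
  open ParentEdges T tree v
  open Labeling v parent depth depth-root depth-zero depth-parent
  open Consistency T v parent partner label (proj₂ (proj₁ (proj₂ tree)))
    edge-is-parent-edge parent-adjacent partner-nonroot partner-involutive label-injective label-root label-edge
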